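{- Let $p$ and $q$ be integers with $q\geq 1$, and let $n\geq 1$ be an integer. Then \[ (q-1)\,H_n^{(p,q)}=(n+q-1)\,H_n^{(p,q-1)}-H_n^{(p-1,q-1)}. \]
   Context: For $p\in\mathbb{Z}$ and integers $n\geq 1$, $r\geq 1$, the generalized hyperharmonic numbers are defined recursively by $H_n^{(p,0)}=1/n^{p}$ and $H_n^{(p,r)}=\sum_{k=1}^{n}H_k^{(p,r-1)}$, with $H_0^{(p,r)}=0$. -}

module Defs where

open import Data.Nat as ℕ using (ℕ; zero; suc)
open import Data.Nat.Properties using (m^n≢0)
open import Data.Integer as ℤ using (ℤ; +_; -[1+_])
open import Data.Rational using (ℚ; _/_; _+_; 0ℚ)

-- invPow n p = 1 / n^p  for n ≥ 1 (given as  suc m) and p ∈ ℤ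
invPow : ℕ → ℤ → ℚ
invPow m (+ k) = (+ 1) / (suc m ℕ.^ k)
  where instance _ = m^n≢0 (suc m) k
invPow m -[1+ k ] = (+ (suc m ℕ.^ suc k)) / 1

sumTo : (ℕ → ℚ) → ℕ → ℚ
sumTo f zero = 0ℚ
sumTo f (suc n) = sumTo f n + f (suc n)

-- Generalized hyperharmonic numbers  H p r n = H_n^{(p,r)}.
-- H_n^{(p,0)} = 1/n^p (n ≥ 1; the value at n = 0, r = 0 is never used and set to 0),
-- H_n^{(p,r)} = Σ_{k=1}^{n} H_k^{(p,r-1)} for r ≥ 1 (so H_0^{(p,r)} = 0).
H : ℤ → ℕ → ℕ → ℚ
H p zero zero = 0ℚ
H p zero (suc m) = invPow m p
H p (suc r) n = sumTo (H p r) n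

{-# OPTIONS --safe #-}
-- With s = q − 1 the identity reads  s H^{(p,s+1)}_n = (n+s) H^{(p,s)}_n − H^{(p−1,s)}_n,
-- which holds for all s, n ≥ 0 and is proved by induction on s and then on n.
-- For s = 0 it is n^{1−p} = n · n^{−p}.  For the step, H^{(p,s+2)}_{m+1} splits as
-- H^{(p,s+2)}_m + H^{(p,s+1)}_{m+1} and H^{(p,s+1)}_{m+1} as H^{(p,s+1)}_m + H^{(p,s)}_{m+1};
-- the sum of the instances at (s+1, m) and (s, m+1), plus H^{(p,s+1)}_{m+1} itself,
-- is the instance at (s+1, m+1).
module Submission where

open import Defs
open import Data.Nat as ℕ using (ℕ; zero; suc; _≥_)
open import Data.Nat.Properties as ℕ using (m^n≢0)
open import Data.Integer as ℤ using (ℤ; +_; -[1+_])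
open import Data.Integer.Properties as ℤ using (pos-+; pos-*)
open import Data.Rational using (ℚ; _/_; _*_; _-_; _+_; 0ℚ; 1ℚ; toℚᵘ)
open import Data.Rational.Properties using (*-distribˡ-+; *-distribʳ-+; *-identityˡ; toℚᵘ-injective; toℚᵘ-fromℚᵘ; toℚᵘ-homo-+; toℚᵘ-homo-*; fromℚᵘ-cong; /-cong)
open import Data.Rational.Unnormalised as ℚᵘ using (mkℚᵘ; *≡*)
open import Data.Rational.Unnormalised.Properties as ℚᵘ using (module ≃-Reasoning)
open import Data.Rational.Solver using (module +-*-Solver)
open import Relation.Binary.PropositionalEquality

toℚᵘ-/ : ∀ i n → toℚᵘ (i / suc n) ℚᵘ.≃ mkℚᵘ i n
toℚᵘ-/ i n = toℚᵘ-fromℚᵘ (mkℚᵘ i n)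

/-≡-cross : ∀ i j m n .{{_ : ℕ.NonZero m}} .{{_ : ℕ.NonZero n}} →
            i ℤ.* + n ≡ j ℤ.* + m → i / m ≡ j / n
/-≡-cross i j (suc m) (suc n) eq = fromℚᵘ-cong {mkℚᵘ i m} {mkℚᵘ j n} (*≡* eq)

/-*-/ : ∀ i j m n .{{_ : ℕ.NonZero m}} .{{_ : ℕ.NonZero n}} →
        (i / m) * (j / n) ≡ _/_ (i ℤ.* j) (m ℕ.* n) {{ℕ.m*n≢0 m n}}
/-*-/ i j (suc m) (suc n) = toℚᵘ-injective (begin
  toℚᵘ ((i / suc m) * (j / suc n))             ≈⟨ toℚᵘ-homo-* (i / suc m) (j / suc n) ⟩
  toℚᵘ (i / suc m) ℚᵘ.* toℚᵘ (j / suc n)       ≈⟨ ℚᵘ.*-cong (toℚᵘ-/ i m) (toℚᵘ-/ j n) ⟩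
  mkℚᵘ i m ℚᵘ.* mkℚᵘ j n                        ≈⟨ toℚᵘ-/ (i ℤ.* j) _ ⟨
  toℚᵘ ((i ℤ.* j) / (suc m ℕ.* suc n))         ∎)
  where open ≃-Reasoning

/-+-/ : ∀ i j m n .{{_ : ℕ.NonZero m}} .{{_ : ℕ.NonZero n}} →
        (i / m) + (j / n) ≡ _/_ (i ℤ.* + n ℤ.+ j ℤ.* + m) (m ℕ.* n) {{ℕ.m*n≢0 m n}}
/-+-/ i j (suc m) (suc n) = toℚᵘ-injective (begin
  toℚᵘ ((i / suc m) + (j / suc n))             ≈⟨ toℚᵘ-homo-+ (i / suc m) (j / suc n) ⟩
  toℚᵘ (i / suc m) ℚᵘ.+ toℚᵘ (j / suc n)       ≈⟨ ℚᵘ.+-cong (toℚᵘ-/ i m) (toℚᵘ-/ j n) ⟩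
  mkℚᵘ i m ℚᵘ.+ mkℚᵘ j n                        ≈⟨ toℚᵘ-/ (i ℤ.* + suc n ℤ.+ j ℤ.* + suc m) _ ⟨
  toℚᵘ ((i ℤ.* + suc n ℤ.+ j ℤ.* + suc m) / (suc m ℕ.* suc n)) ∎)
  where open ≃-Reasoning

fromℕ : ℕ → ℚ
fromℕ k = + k / 1

fromℕ-+ : ∀ a b → fromℕ (a ℕ.+ b) ≡ fromℕ a + fromℕ b
fromℕ-+ a b = sym (trans (/-+-/ (+ a) (+ b) 1 1) (/-cong eq refl))
  where
  eq : + a ℤ.* + 1 ℤ.+ + b ℤ.* + 1 ≡ + (a ℕ.+ b)
  eq = trans (cong₂ ℤ._+_ (ℤ.*-identityʳ (+ a)) (ℤ.*-identityʳ (+ b))) (sym (pos-+ a b))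

fromℕ-suc : ∀ a → fromℕ (suc a) ≡ 1ℚ + fromℕ a
fromℕ-suc = fromℕ-+ 1

fromℕ-suc-* : ∀ a x → fromℕ (suc a) * x ≡ x + fromℕ a * x
fromℕ-suc-* a x = begin
  fromℕ (suc a) * x        ≡⟨ cong (_* x) (fromℕ-suc a) ⟩
  (1ℚ + fromℕ a) * x       ≡⟨ *-distribʳ-+ x 1ℚ (fromℕ a) ⟩
  1ℚ * x + fromℕ a * x     ≡⟨ cong (_+ fromℕ a * x) (*-identityˡ x) ⟩
  x + fromℕ a * x          ∎
  where open ≡-Reasoning

invPow-pred : ∀ m p → invPow m (p ℤ.- + 1) ≡ fromℕ (suc m) * invPow m p
invPow-pred m (+ zero) = sym (trans (/-*-/ (+ suc m) (+ 1) 1 1) (/-cong (sym (pos-* (suc m) 1)) refl))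
invPow-pred m (+ suc k) = sym (trans (/-*-/ (+ suc m) (+ 1) 1 (suc m ℕ.^ suc k))
  (/-≡-cross (+ suc m ℤ.* + 1) (+ 1) (1 ℕ.* suc m ℕ.^ suc k) (suc m ℕ.^ k) {{ℕ.m*n≢0 1 _}} eq))
  where
  instance
    _ = m^n≢0 (suc m) k
    _ = m^n≢0 (suc m) (suc k)
  eq : + suc m ℤ.* + 1 ℤ.* + (suc m ℕ.^ k) ≡ + 1 ℤ.* + (1 ℕ.* (suc m ℕ.^ suc k))
  eq = begin
    + suc m ℤ.* + 1 ℤ.* + (suc m ℕ.^ k)    ≡⟨ cong (ℤ._* + (suc m ℕ.^ k)) (ℤ.*-identityʳ (+ suc m)) ⟩
    + suc m ℤ.* + (suc m ℕ.^ k)            ≡⟨ pos-* (suc m) (suc m ℕ.^ k) ⟨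
    + (suc m ℕ.^ suc k)                    ≡⟨ cong +_ (ℕ.*-identityˡ (suc m ℕ.^ suc k)) ⟨
    + (1 ℕ.* (suc m ℕ.^ suc k))            ≡⟨ ℤ.*-identityˡ _ ⟨
    + 1 ℤ.* + (1 ℕ.* (suc m ℕ.^ suc k))    ∎
    where open ≡-Reasoning
invPow-pred m -[1+ k ] = sym (trans (/-*-/ (+ suc m) (+ (suc m ℕ.^ suc k)) 1 1) (/-cong eq refl))
  where
  eq : + suc m ℤ.* + (suc m ℕ.^ suc k) ≡ + (suc m ℕ.^ suc (suc (k ℕ.+ 0)))
  eq = trans (sym (pos-* (suc m) _)) (cong (λ j → + (suc m ℕ.^ suc (suc j))) (sym (ℕ.+-identityʳ k)))

open +-*-Solver

H-recurrence : ∀ p s n →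
  fromℕ s * H p (suc s) n ≡ fromℕ (n ℕ.+ s) * H p s n - H (p ℤ.- + 1) s n
H-recurrence p zero zero = refl
H-recurrence p zero (suc m) rewrite ℕ.+-identityʳ m | invPow-pred m p =
  solve 3 (λ x y z → con (fromℕ 0) :* x := y :* z :- y :* z) refl (H p 1 (suc m)) (fromℕ (suc m)) (invPow m p)
H-recurrence p (suc s) zero =
  solve 1 (λ x → x :* con 0ℚ := x :* con 0ℚ :- con 0ℚ) refl (fromℕ (suc s))
H-recurrence p (suc s) (suc m) = begin
  fromℕ (suc s) * (A + B)                     ≡⟨ *-distribˡ-+ (fromℕ (suc s)) A B ⟩
  fromℕ (suc s) * A + fromℕ (suc s) * B       ≡⟨ cong (_+_ (fromℕ (suc s) * A)) (fromℕ-suc-* s B) ⟩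
  fromℕ (suc s) * A + (B + fromℕ s * B)       ≡⟨ cong₂ (λ u v → u + (B + v)) (H-recurrence p (suc s) m) shifted ⟩
  (k * D - G₁) + ((D + E) + (k * E - G₀))    ≡⟨ solve 5 (λ k D E G₁ G₀ → (k :* D :- G₁) :+ ((D :+ E) :+ (k :* E :- G₀))
                                                         := (con 1ℚ :+ k) :* (D :+ E) :- (G₁ :+ G₀)) refl k D E G₁ G₀ ⟩
  (1ℚ + k) * B - (G₁ + G₀)                    ≡⟨ cong (λ x → x * B - (G₁ + G₀)) (fromℕ-suc (m ℕ.+ suc s)) ⟨
  fromℕ (suc m ℕ.+ suc s) * B - (G₁ + G₀)     ∎
  where
  open ≡-Reasoning
  A B D E G₁ G₀ k : ℚ
  A = H p (suc (suc s)) m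
  B = H p (suc s) (suc m)
  D = H p (suc s) m
  E = H p s (suc m)
  G₁ = H (p ℤ.- + 1) (suc s) m
  G₀ = H (p ℤ.- + 1) s (suc m)
  k = fromℕ (m ℕ.+ suc s)
  shifted : fromℕ s * B ≡ k * E - G₀
  shifted = subst (λ j → fromℕ s * B ≡ fromℕ j * E - G₀) (sym (ℕ.+-suc m s)) (H-recurrence p s (suc m))

lemma1 : (p : ℤ) (q n : ℕ) → q ≥ 1 → n ≥ 1 →
    ((+ q ℤ.- + 1) / 1) * H p q n
    ≡ ((+ (n ℕ.+ q ℕ.∸ 1)) / 1) * H p (q ℕ.∸ 1) n - H (p ℤ.- + 1) (q ℕ.∸ 1) n
lemma1 p zero n () _
lemma1 p (suc s) n _ _ rewrite ℕ.+-suc n s = H-recurrence p s n
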